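{- Let $A\subseteq\mathcal Z$ be a Scott closed subset and $s\in\mathbb W^*$. If $A$ contains uncountably many elements of $L_s=\{(m,s):m\in\mathbb W\}$, then $L_s\subseteq A$.
   Context: Let $\omega_1$ be the first uncountable ordinal and $\mathbb W=[0,\omega_1)$ the set of countable ordinals with their usual order. Let $\mathbb W^*$ be the set of finite strings of elements of $\mathbb W$, with $\varepsilon$ the empty string; for $u\in\mathbb W$, $s\in\mathbb W^*$, $u.s$ is the string obtained by putting $u$ in front of $s$; for $s,t\in\mathbb W^*$, $ts$ is the concatenation of $t$ followed by $s$; for nonempty $t$, $\min(t)$ is the least ordinal occurring in $t$. On $\mathcal Z=\mathbb W\times\mathbb W^*$ define, for $m,m',u,u'\in\mathbb W$ and $s,t\in\mathbb W^*$: $(m,u.s)<_1(m,u'.s)$ iff $u<u'$; $(m,ts)<_2(m,s)$ iff $t\neq\varepsilon$; $(m,ts)<_3(m',s)$ iff $t\ne\varepsilon$ and $\min(t)\le m'$. With $R;S$ the relational composite, let $<\,=\,<_1\cup<_2\cup<_3\cup(<_2;<_1)\cup(<_3;<_1)$ and $\le\,=\,<\cup=$; this is a partial order and $\mathcal Z$ denotes the resulting poset. Scott closed sets: lower sets containing the supremum of each of their directed subsets whose supremum exists. -}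

module Defs where

open import Agda.Primitive
open import Data.Nat using (ℕ)
open import Data.List using (List; []; _∷_; _++_)
open import Data.Product using (Σ; ∃; _×_; _,_; proj₁; proj₂)
open import Data.Sum using (_⊎_)
open import Data.Unit using (⊤)
open import Relation.Nullary using (¬_)
open import Relation.Binary.Core using (Rel)
open import Relation.Binary.Structures using (IsStrictTotalOrder)
open import Relation.Binary.Definitions using (tri<; tri≈; tri>)
open import Relation.Binary.PropositionalEquality using (_≡_)
open import Induction.WellFounded using (WellFounded)

Countable : {A : Set} → (A → Set) → Set
Countable {A} S = Σ (A → ℕ) λ f → ∀ x y → S x → S y → f x ≡ f y → x ≡ y

Uncountable : {A : Set} → (A → Set) → Set
Uncountable S = ¬ Countable S

-- Excluded middle (the ambient classical metatheory of the paper).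
LEM : Set₁
LEM = (P : Set) → P ⊎ ¬ P

-- ω₁ = [0, ω₁): an (uncountable) well-order all of whose proper initial
-- segments are countable.  This characterises ω₁ up to isomorphism.
record Omega1 : Set₁ where
  field
    W                  : Set
    _<_                : Rel W _
    isStrictTotalOrder : IsStrictTotalOrder _≡_ _<_
    wellFounded        : WellFounded _<_
    initialCountable   : ∀ a → Countable (λ b → b < a)
    uncountable        : Uncountable (λ (_ : W) → ⊤)

module OnΩ (Ω : Omega1) where
  open Omega1 Ω public
  open IsStrictTotalOrder isStrictTotalOrder using (compare)

  _≤W_ : W → W → Set
  u ≤W v = u < v ⊎ u ≡ v

  min2 : W → W → W
  min2 a b with compare a b
  ... | tri< _ _ _ = a
  ... | tri≈ _ _ _ = a
  ... | tri> _ _ _ = b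

  minL : W → List W → W
  minL x []       = x
  minL x (y ∷ t)  = min2 x (minL y t)

  -- 𝒵 = 𝕎 × 𝕎*  (strings as lists; u.s = u ∷ s, ts = t ++ s)
  Z : Set
  Z = W × List W

  data _<₁_ : Z → Z → Set where
    lt₁ : ∀ {m u u' s} → u < u' → (m , u ∷ s) <₁ (m , u' ∷ s)

  -- t ≠ ε is expressed by writing t = x ∷ t'
  data _<₂_ : Z → Z → Set where
    lt₂ : ∀ {m x t s} → (m , (x ∷ t) ++ s) <₂ (m , s)

  data _<₃_ : Z → Z → Set where
    lt₃ : ∀ {m m' x t s} → minL x t ≤W m' → (m , (x ∷ t) ++ s) <₃ (m' , s)

  _⨾_ : Rel Z Agda.Primitive.lzero → Rel Z Agda.Primitive.lzero → Rel Z Agda.Primitive.lzero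
  (R ⨾ S) x z = ∃ λ y → R x y × S y z

  _<Z_ : Z → Z → Set
  x <Z y = x <₁ y ⊎ x <₂ y ⊎ x <₃ y ⊎ (_<₂_ ⨾ _<₁_) x y ⊎ (_<₃_ ⨾ _<₁_) x y

  _≤Z_ : Z → Z → Set
  x ≤Z y = x <Z y ⊎ x ≡ y

  IsUpperBound : (Z → Set) → Z → Set
  IsUpperBound D z = ∀ d → D d → d ≤Z z

  IsSup : (Z → Set) → Z → Set
  IsSup D z = IsUpperBound D z × (∀ z' → IsUpperBound D z' → z ≤Z z')

  Directed : (Z → Set) → Set
  Directed D = (∃ λ d → D d) ×
               (∀ a b → D a → D b → ∃ λ c → D c × a ≤Z c × b ≤Z c)

  LowerSet : (Z → Set) → Set
  LowerSet A = ∀ x y → x ≤Z y → A y → A x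

  ScottClosed : (Z → Set) → Set₁
  ScottClosed A = LowerSet A ×
    ((D : Z → Set) → (∀ d → D d → A d) → Directed D →
      ∀ z → IsSup D z → A z)

  L : List W → Z → Set
  L s z = proj₂ z ≡ s

{-# OPTIONS --safe #-}
-- The points (m , u.s), u ∈ 𝕎, form a chain with supremum (m , s):
-- an upper bound (n , r) of the chain dominates (m , v.s) for some v exceeding n
-- and the first letter of r, and such a comparison survives deleting the letter v.
-- Each (m , u.s) lies <₃-below some (n , s) ∈ A with u < n, because A ∩ L_s,
-- being uncountable, is unbounded in 𝕎 (initial segments of ω₁ are countable).
-- Scott closedness then puts (m , s) in A.
module Submission where

open import Defs
open import Data.List using (List; []; _∷_; head)
open import Data.Maybe.Relation.Unary.All using (All; just; nothing)
open import Data.Nat using (ℕ; zero; suc)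
open import Data.Nat.Properties using (suc-injective)
open import Data.Product using (_×_; ∃; _,_; proj₁)
open import Data.Sum using (_⊎_; inj₁; inj₂)
open import Data.Empty using (⊥-elim)
open import Function using (_∘_)
open import Relation.Nullary using (¬_; yes; no; contradiction)
open import Relation.Binary.Bundles using (StrictTotalOrder; DecTotalOrder)
open import Relation.Binary.Definitions using (DecidableEquality; tri<; tri≈; tri>)
open import Relation.Binary.Structures using (IsStrictTotalOrder)
open import Relation.Binary.PropositionalEquality using (_≡_; _≢_; refl; sym; cong; subst)
import Relation.Binary.Construct.StrictToNonStrict as ToNonStrict
import Relation.Binary.Properties.StrictTotalOrder as StrictTotalOrderProperties
import Algebra.Construct.NaturalChoice.Max as Max

Countable-⊆ : {A : Set} {S T : A → Set} → (∀ x → S x → T x) → Countable T → Countable S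
Countable-⊆ S⊆T (f , f-inj) = f , λ x y Sx Sy → f-inj x y (S⊆T x Sx) (S⊆T y Sy)

Countable-insert : {A : Set} {S : A → Set} → DecidableEquality A → (a : A) →
                   Countable S → Countable (λ x → S x ⊎ x ≡ a)
Countable-insert {A} {S} _≟_ a (f , f-inj) = code , code-inj
  where
  code : A → ℕ
  code x with x ≟ a
  ... | yes _ = zero
  ... | no _  = suc (f x)

  in-S : ∀ {x} → S x ⊎ x ≡ a → x ≢ a → S x
  in-S (inj₁ Sx)  _   = Sx
  in-S (inj₂ x≡a) x≢a = contradiction x≡a x≢a

  code-inj : ∀ x y → S x ⊎ x ≡ a → S y ⊎ y ≡ a → code x ≡ code y → x ≡ y
  code-inj x y Sx Sy eq with x ≟ a | y ≟ a
  ... | yes refl | yes refl = refl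
  ... | no x≢a   | no y≢a   = f-inj x y (in-S Sx x≢a) (in-S Sy y≢a) (suc-injective eq)
  code-inj x y Sx Sy () | yes _ | no _
  code-inj x y Sx Sy () | no _  | yes _

pattern ≡Z            = inj₂ refl
pattern by<₁ p        = inj₁ (inj₁ p)
pattern by<₂ p        = inj₁ (inj₂ (inj₁ p))
pattern by<₃ p        = inj₁ (inj₂ (inj₂ (inj₁ p)))
pattern by<₂⨾<₁ p q   = inj₁ (inj₂ (inj₂ (inj₂ (inj₁ (_ , p , q)))))
pattern by<₃⨾<₁ p q   = inj₁ (inj₂ (inj₂ (inj₂ (inj₂ (_ , p , q)))))

module _ (Ω : Omega1) where
  open OnΩ Ω
  open IsStrictTotalOrder isStrictTotalOrder
    using (compare; irrefl; asym; _≟_; <-respˡ-≈) renaming (trans to <-trans)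

  private
    strictTotalOrder : StrictTotalOrder _ _ _
    strictTotalOrder = record { isStrictTotalOrder = isStrictTotalOrder }

  open StrictTotalOrderProperties strictTotalOrder using (decTotalOrder)
  open Max (DecTotalOrder.totalOrder decTotalOrder) using (_⊔_; x≤x⊔y; x≤y⊔x)

  ≤-<-trans : ∀ {a b c} → a ≤W b → b < c → a < c
  ≤-<-trans = ToNonStrict.≤-<-trans _≡_ _<_ sym <-trans <-respˡ-≈

  ≤⇒≯ : ∀ {a b} → a ≤W b → ¬ b < a
  ≤⇒≯ (inj₁ a<b) b<a = asym a<b b<a
  ≤⇒≯ (inj₂ refl) = irrefl refl

  ≮⇒≥ : ∀ {a b} → ¬ a < b → b ≤W a
  ≮⇒≥ {a} {b} a≮b with compare b a
  ... | tri< b<a _ _ = inj₁ b<a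
  ... | tri≈ _ b≡a _ = inj₂ b≡a
  ... | tri> _ _ a<b = contradiction a<b a≮b

  min2-sel : ∀ a b → min2 a b ≡ a ⊎ min2 a b ≡ b
  min2-sel a b with compare a b
  ... | tri< _ _ _ = inj₁ refl
  ... | tri≈ _ _ _ = inj₁ refl
  ... | tri> _ _ _ = inj₂ refl

  ≤W-countable : ∀ a → Countable (_≤W a)
  ≤W-countable a = Countable-insert _≟_ a (initialCountable a)

  ∷-mono-≤Z : ∀ {m u v s} → u ≤W v → (m , u ∷ s) ≤Z (m , v ∷ s)
  ∷-mono-≤Z (inj₁ u<v)  = by<₁ (lt₁ u<v)
  ∷-mono-≤Z (inj₂ refl) = ≡Z

  drop-<₂ : ∀ {m v s z} → (m , v ∷ s) <₂ z → (m , s) ≡ z ⊎ (m , s) <₂ z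
  drop-<₂ (lt₂ {t = []})    = inj₁ refl
  drop-<₂ (lt₂ {t = _ ∷ _}) = inj₂ lt₂

  drop-<₃ : ∀ {m n v s r} → n < v → (m , v ∷ s) <₃ (n , r) → (m , s) <₃ (n , r)
  drop-<₃ n<v (lt₃ {t = []} v≤n) = contradiction n<v (≤⇒≯ v≤n)
  drop-<₃ {n = n} {v} n<v (lt₃ {t = y ∷ t} min≤n) with min2-sel v (minL y t)
  ... | inj₁ min≡v    = contradiction n<v (≤⇒≯ (subst (_≤W n) min≡v min≤n))
  ... | inj₂ min≡rest = lt₃ (subst (_≤W n) min≡rest min≤n)

  -- n < v excludes a <₃-step whose prefix is just v; the bound on head r
  -- excludes equality and a <₁-step, the cases where v survives in r.
  drop-≤Z : ∀ {m v s n r} → n < v → (m , v ∷ s) ≤Z (n , r) → All (_< v) (head r) →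
            (m , s) ≤Z (n , r)
  drop-≤Z _   ≡Z               (just v<v) = contradiction v<v (irrefl refl)
  drop-≤Z _   (by<₁ (lt₁ v<u)) (just u<v) = contradiction u<v (asym v<u)
  drop-≤Z _   (by<₂ p)         _ with drop-<₂ p
  ... | inj₁ eq = inj₂ eq
  ... | inj₂ q  = by<₂ q
  drop-≤Z n<v (by<₃ p)         _ = by<₃ (drop-<₃ n<v p)
  drop-≤Z _   (by<₂⨾<₁ p q)    _ with drop-<₂ p
  ... | inj₁ refl = by<₁ q
  ... | inj₂ p′   = by<₂⨾<₁ p′ q
  drop-≤Z n<v (by<₃⨾<₁ p (lt₁ u<u′)) _ = by<₃⨾<₁ (drop-<₃ n<v p) (lt₁ u<u′)

  Ray : W → List W → Z → Set
  Ray m s d = ∃ λ v → d ≡ (m , v ∷ s)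

  Ray-directed : ∀ m s → Directed (Ray m s)
  Ray-directed m s = ((m , m ∷ s) , m , refl) , joins
    where
    joins : ∀ a b → Ray m s a → Ray m s b → ∃ λ c → Ray m s c × a ≤Z c × b ≤Z c
    joins _ _ (u , refl) (v , refl) =
      (m , u ⊔ v ∷ s) , (u ⊔ v , refl) , ∷-mono-≤Z (x≤x⊔y u v) , ∷-mono-≤Z (x≤y⊔x u v)

  Countable-onLine : ∀ {A : Z → Set} {s} → Countable (λ m → A (m , s)) →
                     Countable (λ z → A z × L s z)
  Countable-onLine {A} {s} (f , f-inj) = f ∘ proj₁ , code-inj
    where
    code-inj : ∀ x y → A x × L s x → A y × L s y → f (proj₁ x) ≡ f (proj₁ y) → x ≡ y
    code-inj (m , _) (m′ , _) (Am , refl) (Am′ , refl) eq = cong (_, _) (f-inj m m′ Am Am′ eq)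

  module _ (lem : LEM) where

    uncountable⇒unbounded : ∀ {S : W → Set} → Uncountable S → ∀ a → ∃ λ b → S b × a < b
    uncountable⇒unbounded {S} S-unc a with lem (∃ λ b → S b × a < b)
    ... | inj₁ above  = above
    ... | inj₂ ¬above = ⊥-elim (S-unc (Countable-⊆ bounded (≤W-countable a)))
      where
      bounded : ∀ b → S b → b ≤W a
      bounded b Sb = ≮⇒≥ (λ a<b → ¬above (b , Sb , a<b))

    above-head : ∀ n r → ∃ λ v → n < v × All (_< v) (head r)
    above-head n [] with uncountable⇒unbounded uncountable n
    ... | v , _ , n<v = v , n<v , nothing
    above-head n (u ∷ _) with uncountable⇒unbounded uncountable (n ⊔ u)
    ... | v , _ , n⊔u<v = v , ≤-<-trans (x≤x⊔y n u) n⊔u<v , just (≤-<-trans (x≤y⊔x n u) n⊔u<v)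

    Ray-sup : ∀ m s → IsSup (Ray m s) (m , s)
    Ray-sup m s = upper , least
      where
      upper : IsUpperBound (Ray m s) (m , s)
      upper _ (_ , refl) = by<₂ (lt₂ {t = []})

      least : ∀ z → IsUpperBound (Ray m s) z → (m , s) ≤Z z
      least (n , r) z-upper with above-head n r
      ... | v , n<v , head<v = drop-≤Z n<v (z-upper _ (v , refl)) head<v

    Ray⊆ : ∀ {A s} → LowerSet A → Uncountable (λ z → A z × L s z) → ∀ m d → Ray m s d → A d
    Ray⊆ A-lower A-unc m _ (v , refl) with uncountable⇒unbounded (A-unc ∘ Countable-onLine) v
    ... | n , An , v<n = A-lower _ _ (by<₃ (lt₃ {t = []} (inj₁ v<n))) An

mainTheorem15 : (Ω : Omega1) → LEM →
    let open OnΩ Ω in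
    (A : Z → Set) → ScottClosed A → (s : List W) →
    Uncountable (λ z → A z × L s z) → ∀ z → L s z → A z
mainTheorem15 Ω lem A (A-lower , A-closed) s A-unc (m , _) refl =
  A-closed (Ray Ω m s) (Ray⊆ Ω lem A-lower A-unc m) (Ray-directed Ω m s) (m , s) (Ray-sup Ω lem m s)
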